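{- Let $[M;\mathcal L]$ be a mathematical system with restricted argument lists, $M=[S;A_M;P_M;B_M]$. Let $q\in P_M$ and $j\ge0$ be such that $q$ does not occur $j$-ary in the basis axioms $B_M$. Let $z\in X$ be a variable not occurring in $B_S$, put $C=\;\&\,\forall z\sim z,z\;\neg\forall z\sim z,z$, and for a formula $F$ of $[M;\mathcal L]$ let $\mathcal C(F)$ be obtained by replacing every subformula $q\,\lambda_1,\dots,\lambda_j$ ($\lambda_1,\dots,\lambda_j\in\mathcal L$) by $C$. If $[F_1;\dots;F_l]$ is a proof in $[M;\mathcal L]$, then $[\mathcal C(F_1);\dots;\mathcal C(F_l)]$ is again a proof in $[M;\mathcal L]$ (in which $q$ does not occur $j$-ary).
   Context: Framework. $X$ is a countably infinite set of variables. Formulas are written in Polish (prefix) notation. A recursive system $S=[A_S;P_S;B_S]$ consists of a finite alphabet $A_S$ of constant symbols, a finite list $P_S$ of predicate symbols (the same predicate symbol may be used with several arities) and a finite list $B_S$ of basis R-axioms. Lists (argument terms) are strings built from constant symbols and variables. A prime R-formula is either $p\,\lambda_1,\dots,\lambda_i$ ($p\in P_S$, $i\ge0$; $p$ "occurs $i$-ary") or an equation $\sim\lambda,\mu$. An R-formula is a prime R-formula or $\to F\,G$ with $F$ a prime R-formula and $G$ an R-formula; its last prime formula is its R-conclusion. A mathematical system $M=[S;A_M;P_M;B_M]$ with restricted argument lists $\mathcal L$, written $[M;\mathcal L]$, has $A_M\supseteq A_S$, $P_M\supseteq P_S$, a set $\mathcal L$ of lists containing every variable and closed under substituting lists of $\mathcal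 L$ for variables, and a set $B_M$ of formulas (basis axioms) containing the basis R-axioms $B_S$. Formulas: prime formulas $p\,\lambda_1,\dots,\lambda_i$ ($p\in P_M$) and $\sim\lambda,\mu$ with arguments in $\mathcal L$, and $\neg F$, $J\,F\,G$ ($J\in\{\to,\leftrightarrow,\&,\vee\}$), $\forall x\,F$, $\exists x\,F$. $F\frac{\lambda}{x}=\mathrm{SbF}(F;\lambda;x)$ replaces the free occurrences of $x$ by $\lambda$; $\mathrm{CF}(F;\lambda;x)$ means the substitution is collision-free (no variable of $\lambda$ gets bound). Axioms of $[M;\mathcal L]$: the basis axioms; all instances $\alpha(H_1,\dots,H_m)$ of identically true propositional functions $\alpha$; the axioms of equality (reflexivity $\sim x,x$, and substitutivity of equals in equations and in each predicate symbol $p$ of each arity $n$, e.g. $\to\sim y_1,y_1'\cdots\to\sim y_n,y_n'\;\to p\,y_1,\dots,y_n\;p\,y_1',\dots,y_n'$); the quantifier axioms $\to\forall x F\;F$, $\to\forall x\to F\,G\;\to F\,\forall x\,G$ (if $x\notin\mathrm{free}(F)$), $\leftrightarrow\neg\forall x\neg F\;\exists x F$. Rules of inference: (a) write down an axiom; (b) from $F$ and $\to F\,G$ infer $G$; (c) from $F$ infer $F\frac{\lambda}{x}$ if $\lambda\in\mathcal L$ and $\mathrm{CF}(F;\lambda;x)$; (d) from $F$ infer $\forall x\,F$; (e) induction: let $p\in P_S$, $x_1,\dots,x_i$ distinct variables and $G$ a formula such that $x_1,\dots,x_i$ and the variables of $G$ do not occur in $B_S$; for each $F\in B_S$ let $F'$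 be obtained by replacing every $i$-ary subformula $p\,\lambda_1,\dots,\lambda_i$ by $G\frac{\lambda_1}{x_1}\cdots\frac{\lambda_i}{x_i}$; if $F'$ already occurs in the proof for every $F\in B_S$ whose R-conclusion has $p$ occurring $i$-ary, one may write $\to p\,x_1,\dots,x_i\;G$. A proof is a finite list of formulas each obtained by one of the rules from earlier ones. -}

module Defs where

open import Data.Nat using (ℕ; _≡ᵇ_)
open import Data.Bool using (Bool; true; false; if_then_else_; _∧_; _∨_; not)
open import Data.List using (List; []; _∷_; _++_; length; map; lookup; take; foldl; zip; any)
open import Data.List.Membership.Propositional using (_∈_)
open import Data.List.Relation.Unary.All using (All)
open import Data.List.Relation.Unary.Unique.Propositional using (Unique)
open import Data.Fin using (Fin; toℕ)
open import Data.Product using (_×_; _,_)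
open import Relation.Binary.PropositionalEquality using (_≡_)

-- Syntax.  Variables (the countably infinite set X), constant symbols and
-- predicate symbols are all coded by natural numbers.

data Sym : Set where
  con : ℕ → Sym
  var : ℕ → Sym

Lst : Set
Lst = List Sym

data Atom : Set where
  pr  : ℕ → List Lst → Atom      -- p λ₁,…,λᵢ  (p occurs i-ary, i = length)
  eqn : Lst → Lst → Atom

data Conn : Set where
  imp iff and or : Conn

data Formula : Set where
  atom : Atom → Formula
  neg  : Formula → Formula
  bin  : Conn → Formula → Formula → Formula
  all  : ℕ → Formula → Formula
  ex   : ℕ → Formula → Formula

occL : ℕ → Lst → Bool
occL x []            = false
occL x (con _ ∷ s)   = occL x s
occL x (var y ∷ s)   = (y ≡ᵇ x) ∨ occL x s

occLs : ℕ → List Lst → Bool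
occLs x []       = false
occLs x (l ∷ ls) = occL x l ∨ occLs x ls

occA : ℕ → Atom → Bool
occA x (pr _ ls)  = occLs x ls
occA x (eqn l m)  = occL x l ∨ occL x m

occF : ℕ → Formula → Bool
occF x (atom a)    = occA x a
occF x (neg F)     = occF x F
occF x (bin _ F G) = occF x F ∨ occF x G
occF x (all y F)   = (y ≡ᵇ x) ∨ occF x F
occF x (ex y F)    = (y ≡ᵇ x) ∨ occF x F

freeF : ℕ → Formula → Bool
freeF x (atom a)    = occA x a
freeF x (neg F)     = freeF x F
freeF x (bin _ F G) = freeF x F ∨ freeF x G
freeF x (all y F)   = not (y ≡ᵇ x) ∧ freeF x F
freeF x (ex y F)    = not (y ≡ᵇ x) ∧ freeF x F

sbL : Lst → Lst → ℕ → Lst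
sbL []            l x = []
sbL (con c ∷ s)   l x = con c ∷ sbL s l x
sbL (var y ∷ s)   l x = if y ≡ᵇ x then l ++ sbL s l x else var y ∷ sbL s l x

sbLs : List Lst → Lst → ℕ → List Lst
sbLs []       l x = []
sbLs (m ∷ ms) l x = sbL m l x ∷ sbLs ms l x

sbA : Atom → Lst → ℕ → Atom
sbA (pr p ms) l x = pr p (sbLs ms l x)
sbA (eqn m n) l x = eqn (sbL m l x) (sbL n l x)

SbF : Formula → Lst → ℕ → Formula
SbF (atom a)    l x = atom (sbA a l x)
SbF (neg F)     l x = neg (SbF F l x)
SbF (bin J F G) l x = bin J (SbF F l x) (SbF G l x)
SbF (all y F)   l x = if y ≡ᵇ x then all y F else all y (SbF F l x)
SbF (ex y F)    l x = if y ≡ᵇ x then ex y F else ex y (SbF F l x)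

-- no variable of l gets bound when substituting l for the free x in F
CF : Formula → Lst → ℕ → Bool
CF (atom a)    l x = true
CF (neg F)     l x = CF F l x
CF (bin _ F G) l x = CF F l x ∧ CF G l x
CF (all y F)   l x = (y ≡ᵇ x) ∨ ((not (freeF x F) ∨ not (occL y l)) ∧ CF F l x)
CF (ex y F)    l x = (y ≡ᵇ x) ∨ ((not (freeF x F) ∨ not (occL y l)) ∧ CF F l x)

SbFs : Formula → List ℕ → List Lst → Formula
SbFs G (x ∷ xs) (l ∷ ls) = SbFs (SbF G l x) xs ls
SbFs G _        _        = G

mapAtoms : (Atom → Formula) → Formula → Formula
mapAtoms f (atom a)    = f a
mapAtoms f (neg F)     = neg (mapAtoms f F)
mapAtoms f (bin J F G) = bin J (mapAtoms f F) (mapAtoms f G)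
mapAtoms f (all y F)   = all y (mapAtoms f F)
mapAtoms f (ex y F)    = ex y (mapAtoms f F)

isAry : ℕ → ℕ → Atom → Bool
isAry p i (pr r ls) = (r ≡ᵇ p) ∧ (length ls ≡ᵇ i)
isAry p i (eqn _ _) = false

occAry : ℕ → ℕ → Formula → Bool
occAry p i (atom a)    = isAry p i a
occAry p i (neg F)     = occAry p i F
occAry p i (bin _ F G) = occAry p i F ∨ occAry p i G
occAry p i (all _ F)   = occAry p i F
occAry p i (ex _ F)    = occAry p i F

LstOver : List ℕ → Lst → Set
LstOver A l = ∀ {c} → con c ∈ l → c ∈ A

PrimeR : List ℕ → List ℕ → Atom → Set
PrimeR A P (pr p ls) = p ∈ P × All (LstOver A) ls
PrimeR A P (eqn l m) = LstOver A l × LstOver A m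

IsR : List ℕ → List ℕ → Formula → Set
IsR A P (atom a)                   = PrimeR A P a
IsR A P (bin imp (atom a) G)       = PrimeR A P a × IsR A P G
IsR A P _                          = Data.Empty.⊥
  where import Data.Empty

rconc : Formula → Formula
rconc (bin imp (atom a) G) = rconc G
rconc F                    = F

-- Formulas of [M; 𝓛]: predicates from P_M, arguments in 𝓛
-- (constants from A_M are enforced through 𝓛, see MathSystem.L-const)

WFA : List ℕ → (Lst → Set) → Atom → Set
WFA P L (pr p ls) = p ∈ P × All L ls
WFA P L (eqn l m) = L l × L m

WFF : List ℕ → (Lst → Set) → Formula → Set
WFF P L (atom a)    = WFA P L a
WFF P L (neg F)     = WFF P L F
WFF P L (bin _ F G) = WFF P L F × WFF P L G
WFF P L (all _ F)   = WFF P L F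
WFF P L (ex _ F)    = WFF P L F

-- Mathematical system with restricted argument lists [M; 𝓛],
-- M = [S; A_M; P_M; B_M], S = [A_S; P_S; B_S]

record MathSystem : Set₁ where
  field
    AS AM : List ℕ
    PS PM : List ℕ
    BS    : List Formula
    BM    : Formula → Set
    L     : Lst → Set
    AS⊆AM   : ∀ {c} → c ∈ AS → c ∈ AM
    PS⊆PM   : ∀ {p} → p ∈ PS → p ∈ PM
    L-const : ∀ {l} → L l → LstOver AM l
    L-var   : ∀ x → L (var x ∷ [])
    L-sub   : ∀ {m l x} → L m → L l → L (sbL m l x)
    BS-R    : All (IsR AS PS) BS
    BS⊆BM   : ∀ {F} → F ∈ BS → BM F
    BM-wf   : ∀ {F} → BM F → WFF PM L F

data PF : Set where
  pv   : ℕ → PF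
  pneg : PF → PF
  pbin : Conn → PF → PF → PF

evalC : Conn → Bool → Bool → Bool
evalC imp a b = not a ∨ b
evalC iff a b = (a ∧ b) ∨ (not a ∧ not b)
evalC and a b = a ∧ b
evalC or  a b = a ∨ b

evalPF : (ℕ → Bool) → PF → Bool
evalPF v (pv n)       = v n
evalPF v (pneg α)     = not (evalPF v α)
evalPF v (pbin J α β) = evalC J (evalPF v α) (evalPF v β)

IdTrue : PF → Set
IdTrue α = ∀ (v : ℕ → Bool) → evalPF v α ≡ true

inst : (ℕ → Formula) → PF → Formula
inst H (pv n)       = H n
inst H (pneg α)     = neg (inst H α)
inst H (pbin J α β) = bin J (inst H α) (inst H β)

v1 : ℕ → Lst
v1 x = var x ∷ []

_⇒_ : Formula → Formula → Formula
F ⇒ G = bin imp F G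
infixr 5 _⇒_

eqAx : ℕ → ℕ → ℕ → ℕ → Formula
eqAx y₁ y₂ y₁' y₂' =
  atom (eqn (v1 y₁) (v1 y₁')) ⇒ atom (eqn (v1 y₂) (v1 y₂')) ⇒
  atom (eqn (v1 y₁) (v1 y₂)) ⇒ atom (eqn (v1 y₁') (v1 y₂'))

eqHyps : List ℕ → List ℕ → Formula → Formula
eqHyps (y ∷ ys) (y' ∷ ys') G = atom (eqn (v1 y) (v1 y')) ⇒ eqHyps ys ys' G
eqHyps _        _          G = G

predAx : ℕ → List ℕ → List ℕ → Formula
predAx p ys ys' = eqHyps ys ys' (atom (pr p (map v1 ys)) ⇒ atom (pr p (map v1 ys')))

indRepl : ℕ → List ℕ → Formula → Formula → Formula
indRepl p xs G = mapAtoms f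
  where
  f : Atom → Formula
  f (pr r ls) = if (r ≡ᵇ p) ∧ (length ls ≡ᵇ length xs) then SbFs G xs ls else atom (pr r ls)
  f a         = atom a

module _ (M : MathSystem) where
  open MathSystem M

  NotInBS : ℕ → Set
  NotInBS y = ∀ {F} → F ∈ BS → occF y F ≡ false

  data Step (Γ : List Formula) : Formula → Set where
    basis  : ∀ {F} → BM F → Step Γ F
    taut   : ∀ α (H : ℕ → Formula) → IdTrue α → Step Γ (inst H α)
    refl≈  : ∀ x → Step Γ (atom (eqn (v1 x) (v1 x)))
    eq≈    : ∀ y₁ y₂ y₁' y₂' → Step Γ (eqAx y₁ y₂ y₁' y₂')
    eqPred : ∀ p (ys ys' : List ℕ) → p ∈ PM → length ys ≡ length ys' →
             Step Γ (predAx p ys ys')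
    q∀     : ∀ x F → Step Γ (all x F ⇒ F)
    q∀⇒    : ∀ x F G → freeF x F ≡ false →
             Step Γ (all x (F ⇒ G) ⇒ F ⇒ all x G)
    q∃     : ∀ x F → Step Γ (bin iff (neg (all x (neg F))) (ex x F))
    mp     : ∀ {F G} → F ∈ Γ → (F ⇒ G) ∈ Γ → Step Γ G
    sub    : ∀ {F} l x → F ∈ Γ → L l → CF F l x ≡ true → Step Γ (SbF F l x)
    gen    : ∀ {F} x → F ∈ Γ → Step Γ (all x F)
    ind    : ∀ p (xs : List ℕ) G → p ∈ PS → Unique xs → WFF PM L G →
             (∀ {y} → y ∈ xs → NotInBS y) →
             (∀ y → occF y G ≡ true → NotInBS y) →
             (∀ {F} → F ∈ BS → occAry p (length xs) (rconc F) ≡ true →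
                      indRepl p xs G F ∈ Γ) →
             Step Γ (atom (pr p (map v1 xs)) ⇒ G)

  IsProof : List Formula → Set
  IsProof fs = ∀ (i : Fin (length fs)) →
    WFF PM L (lookup fs i) × Step (take (toℕ i) fs) (lookup fs i)

Cz : ℕ → Formula
Cz z = bin and (all z (atom (eqn (v1 z) (v1 z)))) (neg (all z (atom (eqn (v1 z) (v1 z)))))

𝒞 : ℕ → ℕ → ℕ → Formula → Formula
𝒞 q j z = mapAtoms (λ a → if isAry q j a then Cz z else atom a)

-- C = & ∀z ∼z,z ¬∀z ∼z,z is a closed contradiction, so replacing the j-ary
-- q-atoms by C commutes with substitution, with non-freeness and with
-- collision-freeness, and every rule instance of the proof is sent to an
-- instance of the same rule.  Basis axioms are untouched since q does not
-- occur j-ary in them.  The two exceptions become tautologies: an equality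
-- axiom for q (j-ary) turns into  →∼y₁,y₁' ⋯ → C C, and an induction
-- conclusion  → q x₁,…,xⱼ G  turns into  → C 𝒞(G).  The variable conditions
-- of the induction rule survive because C adds only z, which is not in B_S.
module Submission where

open import Defs
open import Data.Bool using (true; false; _∧_; _∨_; not; if_then_else_)
open import Data.Bool.Properties using (∨-conicalˡ; ∨-conicalʳ; ∧-conicalˡ; ∧-conicalʳ; ∨-zeroʳ; T-≡)
open import Data.Fin using (Fin; toℕ; cast; zero; suc)
open import Data.Fin.Properties using (toℕ-cast)
open import Data.List using (List; []; _∷_; map; length; lookup; take)
open import Data.List.Properties using (length-map; take-map)
open import Data.List.Membership.Propositional using (_∈_)
open import Data.List.Membership.Propositional.Properties using (∈-map⁺)
open import Data.List.Relation.Unary.All using (All; universal)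
open import Data.List.Relation.Unary.All.Properties using (map⁺)
open import Data.Nat using (ℕ; suc; _≡ᵇ_)
open import Data.Nat.Properties using (≡ᵇ⇒≡)
open import Data.Product using (Σ-syntax; _×_; _,_)
open import Data.Sum using (_⊎_; inj₁; inj₂; map₁)
open import Function using (_∘_; Equivalence)
open import Relation.Binary.PropositionalEquality

∨-mono-⊎ : ∀ {a a′ b b′} {P : Set} → (a ≡ true → a′ ≡ true ⊎ P) → (b ≡ true → b′ ≡ true ⊎ P) →
           a ∨ b ≡ true → a′ ∨ b′ ≡ true ⊎ P
∨-mono-⊎ {true}  a⇒ _  _ = map₁ (cong (_∨ _)) (a⇒ refl)
∨-mono-⊎ {false} _  b⇒ e = map₁ (λ b′ → trans (cong (_ ∨_) b′) (∨-zeroʳ _)) (b⇒ e)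

IsTautInst : Formula → Set
IsTautInst F = Σ[ α ∈ PF ] Σ[ H ∈ (ℕ → Formula) ] IdTrue α × inst H α ≡ F

tautInst-step : ∀ {M Γ F} → IsTautInst F → Step M Γ F
tautInst-step (α , H , α-true , refl) = taut α H α-true

shiftPF : PF → PF
shiftPF (pv n)       = pv (suc n)
shiftPF (pneg α)     = pneg (shiftPF α)
shiftPF (pbin J α β) = pbin J (shiftPF α) (shiftPF β)

evalPF-shiftPF : ∀ v α → evalPF v (shiftPF α) ≡ evalPF (v ∘ suc) α
evalPF-shiftPF v (pv n)       = refl
evalPF-shiftPF v (pneg α)     = cong not (evalPF-shiftPF v α)
evalPF-shiftPF v (pbin J α β) = cong₂ (evalC J) (evalPF-shiftPF v α) (evalPF-shiftPF v β)

inst-shiftPF : ∀ H α → inst H (shiftPF α) ≡ inst (H ∘ suc) α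
inst-shiftPF H (pv n)       = refl
inst-shiftPF H (pneg α)     = cong neg (inst-shiftPF H α)
inst-shiftPF H (pbin J α β) = cong₂ (bin J) (inst-shiftPF H α) (inst-shiftPF H β)

⇒-tautInst : ∀ A {G} → IsTautInst G → IsTautInst (A ⇒ G)
⇒-tautInst A (α , H , α-true , refl) =
  pbin imp (pv 0) (shiftPF α) , H′ , true′ , cong (A ⇒_) (inst-shiftPF H′ α)
  where
  H′ : ℕ → Formula
  H′ 0       = A
  H′ (suc n) = H n

  true′ : IdTrue (pbin imp (pv 0) (shiftPF α))
  true′ v rewrite evalPF-shiftPF v α | α-true (v ∘ suc) = ∨-zeroʳ (not (v 0))

eqHyps-tautInst : ∀ ys ys′ {G} → IsTautInst G → IsTautInst (eqHyps ys ys′ G)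
eqHyps-tautInst []       _          t = t
eqHyps-tautInst (_ ∷ _)  []         t = t
eqHyps-tautInst (y ∷ ys) (y′ ∷ ys′) t = ⇒-tautInst _ (eqHyps-tautInst ys ys′ t)

⇒-refl-tautInst : ∀ A → IsTautInst (A ⇒ A)
⇒-refl-tautInst A = pbin imp (pv 0) (pv 0) , (λ _ → A) , excluded-middle , refl
  where
  excluded-middle : IdTrue (pbin imp (pv 0) (pv 0))
  excluded-middle v with v 0
  ... | true  = refl
  ... | false = refl

ex-falso-tautInst : ∀ A X → IsTautInst (bin and A (neg A) ⇒ X)
ex-falso-tautInst A X = pbin imp (pbin and (pv 0) (pneg (pv 0))) (pv 1) , H , ex-falso , refl
  where
  H : ℕ → Formula
  H 0       = A
  H (suc _) = X

  ex-falso : IdTrue (pbin imp (pbin and (pv 0) (pneg (pv 0))) (pv 1))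
  ex-falso v with v 0
  ... | true  = refl
  ... | false = refl

module _ (f : Atom → Formula) where

  mapAtoms-inst : ∀ H α → mapAtoms f (inst H α) ≡ inst (mapAtoms f ∘ H) α
  mapAtoms-inst H (pv n)       = refl
  mapAtoms-inst H (pneg α)     = cong neg (mapAtoms-inst H α)
  mapAtoms-inst H (pbin J α β) = cong₂ (bin J) (mapAtoms-inst H α) (mapAtoms-inst H β)

  mapAtoms-eqHyps : (∀ l m → f (eqn l m) ≡ atom (eqn l m)) →
                    ∀ ys ys′ G → mapAtoms f (eqHyps ys ys′ G) ≡ eqHyps ys ys′ (mapAtoms f G)
  mapAtoms-eqHyps f-eqn []       _          G = refl
  mapAtoms-eqHyps f-eqn (_ ∷ _)  []         G = refl
  mapAtoms-eqHyps f-eqn (y ∷ ys) (y′ ∷ ys′) G =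
    cong₂ _⇒_ (f-eqn (v1 y) (v1 y′)) (mapAtoms-eqHyps f-eqn ys ys′ G)

  mapAtoms-WFF : ∀ {P L} → (∀ {a} → WFA P L a → WFF P L (f a)) →
                 ∀ F → WFF P L F → WFF P L (mapAtoms f F)
  mapAtoms-WFF f-wf (atom a)    w        = f-wf w
  mapAtoms-WFF f-wf (neg F)     w        = mapAtoms-WFF f-wf F w
  mapAtoms-WFF f-wf (bin _ F G) (wF , wG) = mapAtoms-WFF f-wf F wF , mapAtoms-WFF f-wf G wG
  mapAtoms-WFF f-wf (all _ F)   w        = mapAtoms-WFF f-wf F w
  mapAtoms-WFF f-wf (ex _ F)    w        = mapAtoms-WFF f-wf F w

  module _ {l : Lst} {x : ℕ} where

    mapAtoms-SbF : (∀ a → f (sbA a l x) ≡ SbF (f a) l x) →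
                   ∀ F → mapAtoms f (SbF F l x) ≡ SbF (mapAtoms f F) l x
    mapAtoms-SbF f-sb (atom a)    = f-sb a
    mapAtoms-SbF f-sb (neg F)     = cong neg (mapAtoms-SbF f-sb F)
    mapAtoms-SbF f-sb (bin J F G) = cong₂ (bin J) (mapAtoms-SbF f-sb F) (mapAtoms-SbF f-sb G)
    mapAtoms-SbF f-sb (all y F) with y ≡ᵇ x
    ... | true  = refl
    ... | false = cong (all y) (mapAtoms-SbF f-sb F)
    mapAtoms-SbF f-sb (ex y F) with y ≡ᵇ x
    ... | true  = refl
    ... | false = cong (ex y) (mapAtoms-SbF f-sb F)

  mapAtoms-SbFs : (∀ a l x → f (sbA a l x) ≡ SbF (f a) l x) →
                  ∀ G xs ls → mapAtoms f (SbFs G xs ls) ≡ SbFs (mapAtoms f G) xs ls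
  mapAtoms-SbFs f-sb G []       _        = refl
  mapAtoms-SbFs f-sb G (_ ∷ _)  []       = refl
  mapAtoms-SbFs f-sb G (x ∷ xs) (l ∷ ls) = begin
    mapAtoms f (SbFs (SbF G l x) xs ls)   ≡⟨ mapAtoms-SbFs f-sb (SbF G l x) xs ls ⟩
    SbFs (mapAtoms f (SbF G l x)) xs ls   ≡⟨ cong (λ H → SbFs H xs ls) (mapAtoms-SbF (λ a → f-sb a l x) G) ⟩
    SbFs (SbF (mapAtoms f G) l x) xs ls   ∎
    where open ≡-Reasoning

  module _ {x : ℕ} (f-free : ∀ a → occA x a ≡ false → freeF x (f a) ≡ false) where

    mapAtoms-freeF : ∀ F → freeF x F ≡ false → freeF x (mapAtoms f F) ≡ false
    mapAtoms-freeF (atom a)    e = f-free a e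
    mapAtoms-freeF (neg F)     e = mapAtoms-freeF F e
    mapAtoms-freeF (bin _ F G) e =
      cong₂ _∨_ (mapAtoms-freeF F (∨-conicalˡ _ _ e)) (mapAtoms-freeF G (∨-conicalʳ _ _ e))
    mapAtoms-freeF (all y F) e with y ≡ᵇ x
    ... | true  = refl
    ... | false = mapAtoms-freeF F e
    mapAtoms-freeF (ex y F) e with y ≡ᵇ x
    ... | true  = refl
    ... | false = mapAtoms-freeF F e

    mapAtoms-nonfree∨ : ∀ F {b} → not (freeF x F) ∨ b ≡ true → not (freeF x (mapAtoms f F)) ∨ b ≡ true
    mapAtoms-nonfree∨ F e with freeF x F in free
    ... | false rewrite mapAtoms-freeF F free = refl
    ... | true  rewrite e = ∨-zeroʳ _

    mapAtoms-CF : ∀ {l} → (∀ a → CF (f a) l x ≡ true) →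
                  ∀ F → CF F l x ≡ true → CF (mapAtoms f F) l x ≡ true
    mapAtoms-CF-binder : ∀ {l} → (∀ a → CF (f a) l x ≡ true) → ∀ y F →
      (y ≡ᵇ x) ∨ ((not (freeF x F) ∨ not (occL y l)) ∧ CF F l x) ≡ true →
      (y ≡ᵇ x) ∨ ((not (freeF x (mapAtoms f F)) ∨ not (occL y l)) ∧ CF (mapAtoms f F) l x) ≡ true

    mapAtoms-CF f-cf (atom a)    _ = f-cf a
    mapAtoms-CF f-cf (neg F)     e = mapAtoms-CF f-cf F e
    mapAtoms-CF f-cf (bin _ F G) e =
      cong₂ _∧_ (mapAtoms-CF f-cf F (∧-conicalˡ _ _ e)) (mapAtoms-CF f-cf G (∧-conicalʳ _ _ e))
    mapAtoms-CF f-cf (all y F)   e = mapAtoms-CF-binder f-cf y F e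
    mapAtoms-CF f-cf (ex y F)    e = mapAtoms-CF-binder f-cf y F e

    mapAtoms-CF-binder f-cf y F e with y ≡ᵇ x
    ... | true  = refl
    ... | false =
      cong₂ _∧_ (mapAtoms-nonfree∨ F (∧-conicalˡ _ _ e)) (mapAtoms-CF f-cf F (∧-conicalʳ _ _ e))

module _ (z : ℕ) where

  freeF-Cz : ∀ x → freeF x (Cz z) ≡ false
  freeF-Cz x with z ≡ᵇ x
  ... | true  = refl
  ... | false = refl

  SbF-Cz : ∀ l x → SbF (Cz z) l x ≡ Cz z
  SbF-Cz l x with z ≡ᵇ x
  ... | true  = refl
  ... | false = refl

  CF-Cz : ∀ l x → CF (Cz z) l x ≡ true
  CF-Cz l x with z ≡ᵇ x
  ... | true  = refl
  ... | false = refl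

  occF-Cz : ∀ y → occF y (Cz z) ≡ true → y ≡ z
  occF-Cz y e with z ≡ᵇ y in z≡ᵇy
  ... | true = sym (≡ᵇ⇒≡ z y (Equivalence.from T-≡ z≡ᵇy))

  WFF-Cz : ∀ {P L} → (∀ x → L (v1 x)) → WFF P L (Cz z)
  WFF-Cz L-var = (L-var z , L-var z) , (L-var z , L-var z)

length-sbLs : ∀ ms l x → length (sbLs ms l x) ≡ length ms
length-sbLs []       l x = refl
length-sbLs (m ∷ ms) l x = cong suc (length-sbLs ms l x)

isAry-sbA : ∀ p i a l x → isAry p i (sbA a l x) ≡ isAry p i a
isAry-sbA p i (pr r ms) l x = cong (λ n → (r ≡ᵇ p) ∧ (n ≡ᵇ i)) (length-sbLs ms l x)
isAry-sbA p i (eqn m n) l x = refl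

isAry-v1 : ∀ p i r {ys ys′} → length ys ≡ length ys′ →
           isAry p i (pr r (map v1 ys)) ≡ isAry p i (pr r (map v1 ys′))
isAry-v1 p i r {ys} {ys′} len =
  cong (λ n → (r ≡ᵇ p) ∧ (n ≡ᵇ i)) (trans (length-map v1 ys) (trans len (sym (length-map v1 ys′))))

module _ (q j z : ℕ) where

  𝒞-atom : Atom → Formula
  𝒞-atom a = if isAry q j a then Cz z else atom a

  𝒞-atom-SbF : ∀ a l x → 𝒞-atom (sbA a l x) ≡ SbF (𝒞-atom a) l x
  𝒞-atom-SbF a l x rewrite isAry-sbA q j a l x with isAry q j a
  ... | true  = sym (SbF-Cz z l x)
  ... | false = refl

  𝒞-atom-freeF : ∀ x a → occA x a ≡ false → freeF x (𝒞-atom a) ≡ false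
  𝒞-atom-freeF x a e with isAry q j a
  ... | true  = freeF-Cz z x
  ... | false = e

  𝒞-atom-CF : ∀ l x a → CF (𝒞-atom a) l x ≡ true
  𝒞-atom-CF l x a with isAry q j a
  ... | true  = CF-Cz z l x
  ... | false = refl

  𝒞-SbF : ∀ l x F → 𝒞 q j z (SbF F l x) ≡ SbF (𝒞 q j z F) l x
  𝒞-SbF l x = mapAtoms-SbF 𝒞-atom (λ a → 𝒞-atom-SbF a l x)

  𝒞-freeF : ∀ x F → freeF x F ≡ false → freeF x (𝒞 q j z F) ≡ false
  𝒞-freeF x = mapAtoms-freeF 𝒞-atom (𝒞-atom-freeF x)

  𝒞-CF : ∀ l x F → CF F l x ≡ true → CF (𝒞 q j z F) l x ≡ true
  𝒞-CF l x = mapAtoms-CF 𝒞-atom (𝒞-atom-freeF x) (𝒞-atom-CF l x)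

  𝒞-WFF : ∀ {P L} → (∀ x → L (v1 x)) → ∀ F → WFF P L F → WFF P L (𝒞 q j z F)
  𝒞-WFF {P} {L} L-var = mapAtoms-WFF 𝒞-atom atom-wf
    where
    atom-wf : ∀ {a} → WFA P L a → WFF P L (𝒞-atom a)
    atom-wf {a} w with isAry q j a
    ... | true  = WFF-Cz z {P} {L} L-var
    ... | false = w

  𝒞-fixes : ∀ F → occAry q j F ≡ false → 𝒞 q j z F ≡ F
  𝒞-fixes (atom a)    e rewrite e = refl
  𝒞-fixes (neg F)     e = cong neg (𝒞-fixes F e)
  𝒞-fixes (bin J F G) e = cong₂ (bin J) (𝒞-fixes F (∨-conicalˡ _ _ e)) (𝒞-fixes G (∨-conicalʳ _ _ e))
  𝒞-fixes (all y F)   e = cong (all y) (𝒞-fixes F e)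
  𝒞-fixes (ex y F)    e = cong (ex y) (𝒞-fixes F e)

  occAry-𝒞 : ∀ F → occAry q j (𝒞 q j z F) ≡ false
  occAry-𝒞 (atom a) with isAry q j a in e
  ... | true  = refl
  ... | false = e
  occAry-𝒞 (neg F)     = occAry-𝒞 F
  occAry-𝒞 (bin J F G) = cong₂ _∨_ (occAry-𝒞 F) (occAry-𝒞 G)
  occAry-𝒞 (all y F)   = occAry-𝒞 F
  occAry-𝒞 (ex y F)    = occAry-𝒞 F

  occF-𝒞 : ∀ y F → occF y (𝒞 q j z F) ≡ true → occF y F ≡ true ⊎ y ≡ z
  occF-𝒞 y (atom a) e with isAry q j a
  ... | true  = inj₂ (occF-Cz z y e)
  ... | false = inj₁ e
  occF-𝒞 y (neg F) e = occF-𝒞 y F e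
  occF-𝒞 y (bin J F G) e = ∨-mono-⊎ (occF-𝒞 y F) (occF-𝒞 y G) e
  occF-𝒞 y (all x F)   e = ∨-mono-⊎ inj₁ (occF-𝒞 y F) e
  occF-𝒞 y (ex x F)    e = ∨-mono-⊎ inj₁ (occF-𝒞 y F) e

  𝒞-indRepl : ∀ p xs G F → occAry q j F ≡ false → 𝒞 q j z (indRepl p xs G F) ≡ indRepl p xs (𝒞 q j z G) F
  𝒞-indRepl p xs G (atom (pr r ls)) e with (r ≡ᵇ p) ∧ (length ls ≡ᵇ length xs)
  ... | true  = mapAtoms-SbFs 𝒞-atom 𝒞-atom-SbF G xs ls
  ... | false = 𝒞-fixes (atom (pr r ls)) e
  𝒞-indRepl p xs G (atom (eqn l m)) e = refl
  𝒞-indRepl p xs G (neg F)     e = cong neg (𝒞-indRepl p xs G F e)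
  𝒞-indRepl p xs G (bin J F H) e =
    cong₂ (bin J) (𝒞-indRepl p xs G F (∨-conicalˡ _ _ e)) (𝒞-indRepl p xs G H (∨-conicalʳ _ _ e))
  𝒞-indRepl p xs G (all y F)   e = cong (all y) (𝒞-indRepl p xs G F e)
  𝒞-indRepl p xs G (ex y F)    e = cong (ex y) (𝒞-indRepl p xs G F e)

lookup-map : ∀ {A B : Set} (f : A → B) xs (i : Fin (length (map f xs))) →
             lookup (map f xs) i ≡ f (lookup xs (cast (length-map f xs) i))
lookup-map f (x ∷ xs) zero    = refl
lookup-map f (x ∷ xs) (suc i) = lookup-map f xs i

module _ (M : MathSystem) where
  open MathSystem M

  IsProof-map : (g : Formula → Formula) →
                (∀ {F} → WFF PM L F → WFF PM L (g F)) →
                (∀ {Γ F} → Step M Γ F → Step M (map g Γ) (g F)) →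
                ∀ fs → IsProof M fs → IsProof M (map g fs)
  IsProof-map g g-wf g-step fs proof i
    rewrite lookup-map g fs i | take-map {f = g} (toℕ i) fs | sym (toℕ-cast (length-map g fs) i)
    with wf , step ← proof (cast (length-map g fs) i)
    = g-wf wf , g-step step

  module _ (q j z : ℕ)
           (q∉BM : ∀ {F} → BM F → occAry q j F ≡ false)
           (z∉BS : NotInBS M z) where

    𝒞-step : ∀ {Γ F} → Step M Γ F → Step M (map (𝒞 q j z) Γ) (𝒞 q j z F)
    𝒞-step (basis {F} b) = subst (Step M _) (sym (𝒞-fixes q j z F (q∉BM b))) (basis b)
    𝒞-step (taut α H α-true) =
      subst (Step M _) (sym (mapAtoms-inst (𝒞-atom q j z) H α)) (taut α (𝒞 q j z ∘ H) α-true)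
    𝒞-step (refl≈ x)            = refl≈ x
    𝒞-step (eq≈ y₁ y₂ y₁′ y₂′)  = eq≈ y₁ y₂ y₁′ y₂′
    𝒞-step (eqPred p ys ys′ p∈PM len)
      rewrite mapAtoms-eqHyps (𝒞-atom q j z) (λ _ _ → refl) ys ys′
                (atom (pr p (map v1 ys)) ⇒ atom (pr p (map v1 ys′)))
      with isAry q j (pr p (map v1 ys)) | isAry q j (pr p (map v1 ys′)) | isAry-v1 q j p {ys} {ys′} len
    ... | true  | true  | _ = tautInst-step (eqHyps-tautInst ys ys′ (⇒-refl-tautInst (Cz z)))
    ... | false | false | _ = eqPred p ys ys′ p∈PM len
    ... | true  | false | ()
    ... | false | true  | ()
    𝒞-step (q∀ x F)             = q∀ x (𝒞 q j z F)
    𝒞-step (q∀⇒ x F G nonfree)  = q∀⇒ x (𝒞 q j z F) (𝒞 q j z G) (𝒞-freeF q j z x F nonfree)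
    𝒞-step (q∃ x F)             = q∃ x (𝒞 q j z F)
    𝒞-step (mp F∈Γ F⇒G∈Γ)       = mp (∈-map⁺ _ F∈Γ) (∈-map⁺ _ F⇒G∈Γ)
    𝒞-step (sub {F} l x F∈Γ l∈L cf) =
      subst (Step M _) (sym (𝒞-SbF q j z l x F)) (sub l x (∈-map⁺ _ F∈Γ) l∈L (𝒞-CF q j z l x F cf))
    𝒞-step (gen x F∈Γ)          = gen x (∈-map⁺ _ F∈Γ)
    𝒞-step {Γ} (ind p xs G p∈PS xs-unique G-wf xs∉BS G∉BS premises)
      with isAry q j (pr p (map v1 xs))
    ... | true  = tautInst-step (ex-falso-tautInst _ (𝒞 q j z G))
    ... | false = ind p xs (𝒞 q j z G) p∈PS xs-unique (𝒞-WFF q j z L-var G G-wf) xs∉BS 𝒞G∉BS 𝒞-premises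
      where
      𝒞G∉BS : ∀ y → occF y (𝒞 q j z G) ≡ true → NotInBS M y
      𝒞G∉BS y y∈𝒞G with occF-𝒞 q j z y G y∈𝒞G
      ... | inj₁ y∈G = G∉BS y y∈G
      ... | inj₂ refl = z∉BS

      𝒞-premises : ∀ {F} → F ∈ BS → occAry p (length xs) (rconc F) ≡ true →
                   indRepl p xs (𝒞 q j z G) F ∈ map (𝒞 q j z) Γ
      𝒞-premises {F} F∈BS p∈F =
        subst (_∈ map (𝒞 q j z) Γ) (𝒞-indRepl q j z p xs G F (q∉BM (BS⊆BM F∈BS)))
              (∈-map⁺ _ (premises F∈BS p∈F))

mainTheorem2 : (M : MathSystem) (q j z : ℕ) →
    q ∈ MathSystem.PM M →
    (∀ {F} → MathSystem.BM M F → occAry q j F ≡ false) →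
    (∀ {F} → F ∈ MathSystem.BS M → occF z F ≡ false) →
    (fs : List Formula) → IsProof M fs →
    IsProof M (map (𝒞 q j z) fs) × All (λ F → occAry q j F ≡ false) (map (𝒞 q j z) fs)
mainTheorem2 M q j z _ q∉BM z∉BS fs proof =
  IsProof-map M (𝒞 q j z) (λ {F} → 𝒞-WFF q j z {PM} {L} L-var F) (𝒞-step M q j z q∉BM z∉BS) fs proof ,
  map⁺ (universal (occAry-𝒞 q j z) fs)
  where open MathSystem M using (PM; L; L-var)
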